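{- Let $p$ be a prime and $s$ a positive integer with $s\le p$, and let $\Gamma_s=\Delta_{2p,2p-s}$. Then no two distinct even elements of $\mathbb Z/2p\mathbb Z$ are adjacent in $\Gamma_s$. Moreover, if $s$ is even, then no two distinct odd elements of $\mathbb Z/2p\mathbb Z$ are adjacent in $\Gamma_s$.
   Context: For integers $0<\ell<n$, $\Delta_{n,\ell}$ is the simplicial complex of all subsets $S\subseteq\mathbb Z/n\mathbb Z$ such that there are no nonnegative integers $c_s$ ($s\in S$) with $\sum_{s\in S}c_s=\ell$ and $\sum_{s\in S}c_s s=0$ in $\mathbb Z/n\mathbb Z$. Two distinct elements $i,j$ are adjacent in a complex $\Gamma$ if $\{i,j\}\in\Gamma$. An element $N\in\mathbb Z/2p\mathbb Z$ is even if $N=2M$ for some $M\in\mathbb Z/2p\mathbb Z$, and odd otherwise. -}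

module Defs where

open import Data.Nat using (ℕ; zero; suc; _+_; _*_)
open import Data.Nat.Divisibility using (_∣_)
open import Data.Fin using (Fin; toℕ)
open import Data.Fin.Subset using (Subset; _∈_; _∉_; _∪_; ⁅_⁆)
open import Data.Product using (Σ; _×_; ∃)
open import Relation.Binary.PropositionalEquality using (_≡_; _≢_)
open import Relation.Nullary using (¬_)

sumFin : (n : ℕ) → (Fin n → ℕ) → ℕ
sumFin zero    f = 0
sumFin (suc n) f = f Fin.zero + sumFin n (λ i → f (Fin.suc i))

_≡_[mod_] : ℕ → ℕ → ℕ → Set
a ≡ b [mod n ] = Σ ℕ λ k → Σ ℕ λ l → a + k * n ≡ b + l * n

-- Z/nZ is represented by Fin n (residues 0..n-1); subsets by Data.Fin.Subset.
Δ : (n ℓ : ℕ) → Subset n → Set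
Δ n ℓ S = ¬ (Σ (Fin n → ℕ) λ c →
              (∀ x → x ∉ S → c x ≡ 0)
            × sumFin n c ≡ ℓ
            × n ∣ sumFin n (λ x → c x * toℕ x))

Adjacent : {n : ℕ} → (Subset n → Set) → Fin n → Fin n → Set
Adjacent Γ i j = i ≢ j × Γ (⁅ i ⁆ ∪ ⁅ j ⁆)

EvenElt : {n : ℕ} → Fin n → Set
EvenElt {n} N = Σ (Fin n) λ M → toℕ N ≡ 2 * toℕ M [mod n ]

OddElt : {n : ℕ} → Fin n → Set
OddElt N = ¬ EvenElt N

-- Write the two elements as i = e + 2a and j = e + 2b with e ∈ {0,1} and a ≠ b < p, and take
-- coefficients c and ℓ − c, where ℓ = 2p − s ≥ p. Then c·i + (ℓ − c)·j = ℓ·j + 2c(a − b), and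
-- ℓ·e is even (e = 0, or e = 1 and s even), so 2p divides it iff p divides ℓe/2 + ℓb + c(a − b).
-- As a − b is invertible modulo the prime p, some c < p ≤ ℓ does this, so {i, j} ∉ Γ_s.
module Submission where

open import Defs
open import Data.Nat using (ℕ; zero; suc; _+_; _*_; _∸_; _≤_; _<_; s≤s; z≤n; NonZero; >-nonZero; compare; less; equal; greater)
open import Data.Nat.Properties
open import Data.Nat.Divisibility
open import Data.Nat.DivMod using (_%_; _/_; m≡m%n+[m/n]*n; m%n<n)
open import Data.Nat.Primality using (Prime)
open import Data.Nat.Coprimality using (prime⇒coprime; coprime-Bézout)
open import Data.Nat.GCD using (module Bézout)
open import Data.Nat.Tactic.RingSolver using (solve-∀)
open import Data.Fin using (Fin; zero; suc; toℕ; fromℕ<)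
open import Data.Fin.Properties using (toℕ-injective; toℕ<n; toℕ-fromℕ<)
open import Data.Fin.Subset using (_∉_; _∪_; ⁅_⁆)
open import Data.Fin.Subset.Properties using (x∈⁅x⁆; x∈p∪q⁺)
open import Data.Product using (_×_; _,_; ∃-syntax)
open import Data.Sum using (_⊎_; inj₁; inj₂)
open import Data.Empty using (⊥-elim)
open import Relation.Nullary using (¬_)
open import Relation.Binary.PropositionalEquality

open ≡-Reasoning

prime⇒∃[u]∣u*d+1 : ∀ {p d} → Prime p → 0 < d → d < p → ∃[ u ] p ∣ u * d + 1
prime⇒∃[u]∣u*d+1 {suc q} {d} pp 0<d d<p
  with coprime-Bézout (prime⇒coprime pp {{>-nonZero 0<d}} d<p)
... | Bézout.+- x y eq = y , divides x (trans (+-comm (y * d) 1) eq)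
... | Bézout.-+ x y eq = y * q , divides (1 + q * x) (begin
  y * q * d + 1            ≡⟨ reassoc y q d ⟩
  q * (y * d) + 1          ≡⟨ cong (λ z → q * z + 1) (sym eq) ⟩
  q * (1 + x * suc q) + 1  ≡⟨ factor q x ⟩
  (1 + q * x) * suc q      ∎)
  where
  reassoc : ∀ y q d → y * q * d + 1 ≡ q * (y * d) + 1
  reassoc = solve-∀
  factor : ∀ q x → q * (1 + x * suc q) + 1 ≡ (1 + q * x) * suc q
  factor = solve-∀

∣X*d+t⇒∣X%n*d+t : ∀ n X d t .{{_ : NonZero n}} → n ∣ X * d + t → n ∣ X % n * d + t
∣X*d+t⇒∣X%n*d+t n X d t n∣ = ∣m+n∣m⇒∣n (subst (n ∣_) split n∣) (n∣m*n (X / n * d))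
  where
  split : X * d + t ≡ X / n * d * n + (X % n * d + t)
  split = begin
    X * d + t                          ≡⟨ cong (λ z → z * d + t) (m≡m%n+[m/n]*n X n) ⟩
    (X % n + X / n * n) * d + t        ≡⟨ expand (X % n) (X / n) n d t ⟩
    X / n * d * n + (X % n * d + t)    ∎
    where
    expand : ∀ r k n d t → (r + k * n) * d + t ≡ k * d * n + (r * d + t)
    expand = solve-∀

prime⇒linearCongruence : ∀ {p d} → Prime p → 0 < d → d < p → ∀ t → ∃[ c ] c < p × p ∣ c * d + t
prime⇒linearCongruence {p@(suc _)} {d} pp 0<d d<p t
  with u , p∣ud+1 ← prime⇒∃[u]∣u*d+1 pp 0<d d<p =
  u * t % p , m%n<n (u * t) p , ∣X*d+t⇒∣X%n*d+t p (u * t) d t (subst (p ∣_) rearrange (∣n⇒∣m*n t p∣ud+1))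
  where
  rearrange : t * (u * d + 1) ≡ u * t * d + t
  rearrange = lemma t u d
    where
    lemma : ∀ t u d → t * (u * d + 1) ≡ u * t * d + t
    lemma = solve-∀

ZeroSumPair : (n ℓ x y : ℕ) → Set
ZeroSumPair n ℓ x y = ∃[ cx ] ∃[ cy ] cx + cy ≡ ℓ × n ∣ cx * x + cy * y

zeroSumPair-sym : ∀ {n ℓ x y} → ZeroSumPair n ℓ x y → ZeroSumPair n ℓ y x
zeroSumPair-sym {n} {x = x} {y} (cx , cy , sum≡ℓ , n∣) =
  cy , cx , trans (+-comm cy cx) sum≡ℓ , subst (n ∣_) (+-comm (cx * x) (cy * y)) n∣

zeroSumPair-< : ∀ {p ℓ e h} b k → Prime p → p ≤ ℓ → ℓ * e ≡ 2 * h → suc (b + k) < p →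
  ZeroSumPair (2 * p) ℓ (e + 2 * suc (b + k)) (e + 2 * b)
zeroSumPair-< {p} {ℓ} {e} {h} b k pp p≤ℓ ℓe≡2h a<p
  with c , c<p , p∣ ← prime⇒linearCongruence pp (s≤s z≤n) (≤-<-trans (s≤s (m≤n+m k b)) a<p) (h + ℓ * b) =
  c , ℓ ∸ c , c+[ℓ∸c]≡ℓ , subst (2 * p ∣_) (sym weighted) (*-monoʳ-∣ 2 p∣)
  where
  c+[ℓ∸c]≡ℓ : c + (ℓ ∸ c) ≡ ℓ
  c+[ℓ∸c]≡ℓ = m+[n∸m]≡n (≤-trans (<⇒≤ c<p) p≤ℓ)
  regroup : ∀ c m e b k → c * (e + 2 * suc (b + k)) + m * (e + 2 * b)
                        ≡ (c + m) * (e + 2 * b) + 2 * (c * suc k)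
  regroup = solve-∀
  expand : ∀ ℓ e b x → ℓ * (e + 2 * b) + 2 * x ≡ ℓ * e + 2 * (x + ℓ * b)
  expand = solve-∀
  collect : ∀ h x y → 2 * h + 2 * (x + y) ≡ 2 * (x + (h + y))
  collect = solve-∀
  weighted : c * (e + 2 * suc (b + k)) + (ℓ ∸ c) * (e + 2 * b) ≡ 2 * (c * suc k + (h + ℓ * b))
  weighted = begin
    c * (e + 2 * suc (b + k)) + (ℓ ∸ c) * (e + 2 * b)   ≡⟨ regroup c (ℓ ∸ c) e b k ⟩
    (c + (ℓ ∸ c)) * (e + 2 * b) + 2 * (c * suc k)       ≡⟨ cong (λ z → z * (e + 2 * b) + 2 * (c * suc k)) c+[ℓ∸c]≡ℓ ⟩
    ℓ * (e + 2 * b) + 2 * (c * suc k)                   ≡⟨ expand ℓ e b (c * suc k) ⟩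
    ℓ * e + 2 * (c * suc k + ℓ * b)                     ≡⟨ cong (_+ 2 * (c * suc k + ℓ * b)) ℓe≡2h ⟩
    2 * h + 2 * (c * suc k + ℓ * b)                     ≡⟨ collect h (c * suc k) (ℓ * b) ⟩
    2 * (c * suc k + (h + ℓ * b))                       ∎

zeroSumPair-sameParity : ∀ {p ℓ e h} a b → Prime p → p ≤ ℓ → ℓ * e ≡ 2 * h → a < p → b < p → a ≢ b →
  ZeroSumPair (2 * p) ℓ (e + 2 * a) (e + 2 * b)
zeroSumPair-sameParity {h = h} a b pp p≤ℓ ℓe≡2h a<p b<p a≢b with compare a b
... | less .a k    = zeroSumPair-sym (zeroSumPair-< {h = h} a k pp p≤ℓ ℓe≡2h b<p)
... | equal .a     = ⊥-elim (a≢b refl)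
... | greater .b k = zeroSumPair-< {h = h} b k pp p≤ℓ ℓe≡2h a<p

δ : ∀ {n} → Fin n → Fin n → ℕ
δ zero    zero    = 1
δ zero    (suc _) = 0
δ (suc _) zero    = 0
δ (suc i) (suc x) = δ i x

δ≡0⊎≡ : ∀ {n} (i x : Fin n) → δ i x ≡ 0 ⊎ i ≡ x
δ≡0⊎≡ zero    zero    = inj₂ refl
δ≡0⊎≡ zero    (suc x) = inj₁ refl
δ≡0⊎≡ (suc i) zero    = inj₁ refl
δ≡0⊎≡ (suc i) (suc x) with δ≡0⊎≡ i x
... | inj₁ δ≡0 = inj₁ δ≡0
... | inj₂ i≡x = inj₂ (cong suc i≡x)

sumFin-0 : ∀ n → sumFin n (λ _ → 0) ≡ 0
sumFin-0 zero    = refl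
sumFin-0 (suc n) = sumFin-0 n

sumFin-cong : ∀ n {f g : Fin n → ℕ} → (∀ x → f x ≡ g x) → sumFin n f ≡ sumFin n g
sumFin-cong zero    f≗g = refl
sumFin-cong (suc n) f≗g = cong₂ _+_ (f≗g zero) (sumFin-cong n (λ x → f≗g (suc x)))

sumFin-+ : ∀ n (f g : Fin n → ℕ) → sumFin n (λ x → f x + g x) ≡ sumFin n f + sumFin n g
sumFin-+ zero    f g = refl
sumFin-+ (suc n) f g = begin
  f zero + g zero + sumFin n (λ x → f (suc x) + g (suc x))
    ≡⟨ cong (f zero + g zero +_) (sumFin-+ n (λ x → f (suc x)) (λ x → g (suc x))) ⟩
  f zero + g zero + (sumFin n (λ x → f (suc x)) + sumFin n (λ x → g (suc x)))
    ≡⟨ +-transpose (f zero) (g zero) _ _ ⟩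
  f zero + sumFin n (λ x → f (suc x)) + (g zero + sumFin n (λ x → g (suc x)))  ∎
  where
  +-transpose : ∀ a b c d → a + b + (c + d) ≡ a + c + (b + d)
  +-transpose = solve-∀

sumFin-δ : ∀ n (i : Fin n) (f : Fin n → ℕ) → sumFin n (λ x → δ i x * f x) ≡ f i
sumFin-δ (suc n) zero    f = trans (cong (f zero + 0 +_) (sumFin-0 n)) (trans (+-identityʳ _) (+-identityʳ _))
sumFin-δ (suc n) (suc i) f = sumFin-δ n i (λ x → f (suc x))

zeroSumPair⇒¬Δ : ∀ {n ℓ} (i j : Fin n) → ZeroSumPair n ℓ (toℕ i) (toℕ j) → ¬ Δ n ℓ (⁅ i ⁆ ∪ ⁅ j ⁆)
zeroSumPair⇒¬Δ {n} {ℓ} i j (ci , cj , ci+cj≡ℓ , n∣) inΔ =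
  inΔ (c , supported , total , subst (n ∣_) (sym weighted) n∣)
  where
  c : Fin n → ℕ
  c x = δ i x * ci + δ j x * cj
  supported : ∀ x → x ∉ ⁅ i ⁆ ∪ ⁅ j ⁆ → c x ≡ 0
  supported x x∉ with δ≡0⊎≡ i x | δ≡0⊎≡ j x
  ... | inj₂ refl | _         = ⊥-elim (x∉ (x∈p∪q⁺ (inj₁ (x∈⁅x⁆ x))))
  ... | inj₁ _    | inj₂ refl = ⊥-elim (x∉ (x∈p∪q⁺ (inj₂ (x∈⁅x⁆ x))))
  ... | inj₁ δi≡0 | inj₁ δj≡0 rewrite δi≡0 | δj≡0 = refl
  total : sumFin n c ≡ ℓ
  total = begin
    sumFin n c                                                     ≡⟨ sumFin-+ n _ _ ⟩
    sumFin n (λ x → δ i x * ci) + sumFin n (λ x → δ j x * cj)      ≡⟨ cong₂ _+_ (sumFin-δ n i _) (sumFin-δ n j _) ⟩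
    ci + cj                                                        ≡⟨ ci+cj≡ℓ ⟩
    ℓ                                                              ∎
  distribute : ∀ a b ci cj x → (a * ci + b * cj) * x ≡ a * (ci * x) + b * (cj * x)
  distribute = solve-∀
  weighted : sumFin n (λ x → c x * toℕ x) ≡ ci * toℕ i + cj * toℕ j
  weighted = begin
    sumFin n (λ x → c x * toℕ x)
      ≡⟨ sumFin-cong n (λ x → distribute (δ i x) (δ j x) ci cj (toℕ x)) ⟩
    sumFin n (λ x → δ i x * (ci * toℕ x) + δ j x * (cj * toℕ x))
      ≡⟨ sumFin-+ n _ _ ⟩
    sumFin n (λ x → δ i x * (ci * toℕ x)) + sumFin n (λ x → δ j x * (cj * toℕ x))
      ≡⟨ cong₂ _+_ (sumFin-δ n i _) (sumFin-δ n j _) ⟩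
    ci * toℕ i + cj * toℕ j  ∎

even⊎odd : ∀ m → ∃[ a ] m ≡ 2 * a ⊎ ∃[ a ] m ≡ 1 + 2 * a
even⊎odd zero = inj₁ (0 , refl)
even⊎odd (suc m) with even⊎odd m
... | inj₁ (a , m≡2a)   = inj₂ (a , cong suc m≡2a)
... | inj₂ (a , m≡1+2a) = inj₁ (suc a , trans (cong suc m≡1+2a) (sym (*-distribˡ-+ 2 1 a)))

EvenElt⇒2∣toℕ : ∀ {n} → 2 ∣ n → (i : Fin n) → EvenElt i → 2 ∣ toℕ i
EvenElt⇒2∣toℕ {n} 2∣n i (M , k , l , i+kn≡2M+ln) =
  ∣m+n∣m⇒∣n (subst (2 ∣_) (+-comm (toℕ i) (k * n)) 2∣i+kn) (∣n⇒∣m*n k 2∣n)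
  where
  2∣i+kn : 2 ∣ toℕ i + k * n
  2∣i+kn = subst (2 ∣_) (sym i+kn≡2M+ln) (∣m∣n⇒∣m+n (m∣m*n (toℕ M)) (∣n⇒∣m*n l 2∣n))

2∣toℕ⇒EvenElt : ∀ {n} (i : Fin n) → 2 ∣ toℕ i → EvenElt i
2∣toℕ⇒EvenElt {n} i (divides q i≡2q) = fromℕ< q<n , 0 , 0 , cong (_+ 0) i≡2M
  where
  q<n : q < n
  q<n = ≤-<-trans (≤-trans (m≤m*n q 2) (≤-reflexive (sym i≡2q))) (toℕ<n i)
  i≡2M : toℕ i ≡ 2 * toℕ (fromℕ< q<n)
  i≡2M = trans i≡2q (trans (*-comm q 2) (cong (2 *_) (sym (toℕ-fromℕ< q<n))))

EvenElt⇒toℕ≡2a : ∀ m (i : Fin (2 * m)) → EvenElt i → ∃[ a ] toℕ i ≡ 0 + 2 * a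
EvenElt⇒toℕ≡2a m i even with divides a i≡a*2 ← EvenElt⇒2∣toℕ (m∣m*n m) i even =
  a , trans i≡a*2 (*-comm a 2)

OddElt⇒toℕ≡1+2a : ∀ {n} (i : Fin n) → OddElt i → ∃[ a ] toℕ i ≡ 1 + 2 * a
OddElt⇒toℕ≡1+2a i odd with even⊎odd (toℕ i)
... | inj₁ (a , i≡2a) = ⊥-elim (odd (2∣toℕ⇒EvenElt i (divides a (trans i≡2a (*-comm 2 a)))))
... | inj₂ odd-form  = odd-form

e+2a<2p⇒a<p : ∀ e {a p} → e + 2 * a < 2 * p → a < p
e+2a<2p⇒a<p e {a} {p} e+2a<2p = *-cancelˡ-< 2 a p (≤-<-trans (m≤n+m (2 * a) e) e+2a<2p)

s≤p⇒p≤2p∸s : ∀ {p s} → s ≤ p → p ≤ 2 * p ∸ s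
s≤p⇒p≤2p∸s {p} s≤p = ≤-trans (≤-reflexive (sym 2p∸p≡p)) (∸-monoʳ-≤ (2 * p) s≤p)
  where
  2p∸p≡p : 2 * p ∸ p ≡ p
  2p∸p≡p = trans (m+n∸m≡n p (p + 0)) (+-identityʳ p)

sameParity⇒¬Adjacent : ∀ {p ℓ e h a b} → Prime p → p ≤ ℓ → ℓ * e ≡ 2 * h →
  (i j : Fin (2 * p)) → toℕ i ≡ e + 2 * a → toℕ j ≡ e + 2 * b → ¬ Adjacent (Δ (2 * p) ℓ) i j
sameParity⇒¬Adjacent {p} {ℓ} {e} {h} {a} {b} pp p≤ℓ ℓe≡2h i j i≡e+2a j≡e+2b (i≢j , inΔ) =
  zeroSumPair⇒¬Δ i j (subst₂ (ZeroSumPair (2 * p) ℓ) (sym i≡e+2a) (sym j≡e+2b) relation) inΔ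
  where
  a≢b : a ≢ b
  a≢b a≡b = i≢j (toℕ-injective (trans i≡e+2a (trans (cong (λ z → e + 2 * z) a≡b) (sym j≡e+2b))))
  relation : ZeroSumPair (2 * p) ℓ (e + 2 * a) (e + 2 * b)
  relation = zeroSumPair-sameParity {h = h} a b pp p≤ℓ ℓe≡2h
    (e+2a<2p⇒a<p e (subst (_< 2 * p) i≡e+2a (toℕ<n i)))
    (e+2a<2p⇒a<p e (subst (_< 2 * p) j≡e+2b (toℕ<n j))) a≢b

lemma4p3 : (p s : ℕ) → Prime p → 1 ≤ s → s ≤ p →
    ((i j : Fin (2 * p)) → EvenElt i → EvenElt j → ¬ Adjacent (Δ (2 * p) (2 * p ∸ s)) i j)
    × (2 ∣ s → (i j : Fin (2 * p)) → OddElt i → OddElt j → ¬ Adjacent (Δ (2 * p) (2 * p ∸ s)) i j)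
lemma4p3 p s pp _ s≤p = evens , odds
  where
  ℓ = 2 * p ∸ s
  evens : (i j : Fin (2 * p)) → EvenElt i → EvenElt j → ¬ Adjacent (Δ (2 * p) ℓ) i j
  evens i j ei ej with a , i≡ ← EvenElt⇒toℕ≡2a p i ei | b , j≡ ← EvenElt⇒toℕ≡2a p j ej =
    sameParity⇒¬Adjacent {h = 0} {a} {b} pp (s≤p⇒p≤2p∸s s≤p) (*-zeroʳ ℓ) i j i≡ j≡
  odds : 2 ∣ s → (i j : Fin (2 * p)) → OddElt i → OddElt j → ¬ Adjacent (Δ (2 * p) ℓ) i j
  odds (divides q s≡q*2) i j oi oj
    with a , i≡ ← OddElt⇒toℕ≡1+2a i oi | b , j≡ ← OddElt⇒toℕ≡1+2a j oj =
    sameParity⇒¬Adjacent {h = p ∸ q} {a} {b} pp (s≤p⇒p≤2p∸s s≤p) ℓ*1≡2[p∸q] i j i≡ j≡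
    where
    ℓ*1≡2[p∸q] : ℓ * 1 ≡ 2 * (p ∸ q)
    ℓ*1≡2[p∸q] = trans (*-identityʳ ℓ) (trans (cong (2 * p ∸_) (trans s≡q*2 (*-comm q 2))) (sym (*-distribˡ-∸ 2 p q)))
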